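{- Let $k\ge 3$ and let $\mathcal C$ be the class of Eulerian planar digraphs whose (underlying undirected graph has) treewidth at most $k$. Then $\mathcal C$ is not well-quasi-ordered by strong immersion: there is an infinite sequence $G_1,G_2,\dots$ in $\mathcal C$ such that for no $i<j$ does $G_i$ strongly immerse into $G_j$.
   Context: All digraphs are finite and may contain loops and parallel edges. A digraph is Eulerian if every vertex has in-degree equal to its out-degree; it is planar if its underlying undirected graph is planar, and its treewidth is that of its underlying undirected graph. A path in a digraph is a sequence $(e_1,\dots,e_m)$ of pairwise distinct edges with $\mathrm{head}(e_i)=\mathrm{tail}(e_{i+1})$ (vertices may repeat); its internal vertices are $\mathrm{head}(e_1),\dots,\mathrm{head}(e_{m-1})$. An immersion of $H$ into $G$ maps vertices of $H$ injectively to vertices of $G$ and each edge $(u,v)$ of $H$ to a path of $G$ from the image of $u$ to the image of $v$, with pairwise edge-disjoint paths for distinct edges; it is strong if no image of a vertex of $H$ is an internal vertex of any of these paths. -}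

module Defs where

open import Data.Nat using (ℕ; zero; suc; _+_; _*_; _≤_)
open import Data.Fin using (Fin; toℕ) renaming (zero to fzero; suc to fsuc)
open import Data.Fin.Properties using (_≟_)
open import Data.Bool using (Bool; true; false; not)
open import Data.List using (List; []; _∷_; length; filter; allFin)
open import Data.List.Membership.Propositional using (_∈_; _∉_)
open import Data.List.Relation.Unary.Unique.Propositional using (Unique)
open import Data.Product using (Σ; ∃; ∃-syntax; _×_; _,_)
open import Data.Sum using (_⊎_)
open import Function.Base using (_∘_)
open import Function.Bundles using (_↔_; Inverse)
open import Function.Definitions using (Injective; Surjective)
open import Relation.Binary.PropositionalEquality using (_≡_; _≢_)
open import Relation.Binary.Construct.Closure.ReflexiveTransitive using (Star)
open import Relation.Nullary using (¬_)

record Digraph : Set where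
  field
    V    : ℕ
    E    : ℕ
    tail : Fin E → Fin V
    head : Fin E → Fin V

open Digraph public using (V; E)

outdeg : (G : Digraph) → Fin (V G) → ℕ
outdeg G v = length (filter (λ e → Digraph.tail G e ≟ v) (allFin (E G)))

indeg : (G : Digraph) → Fin (V G) → ℕ
indeg G v = length (filter (λ e → Digraph.head G e ≟ v) (allFin (E G)))

Eulerian : Digraph → Set
Eulerian G = ∀ v → indeg G v ≡ outdeg G v

data Walk (G : Digraph) : Fin (V G) → Fin (V G) → List (Fin (E G)) → Set where
  single : ∀ e → Walk G (Digraph.tail G e) (Digraph.head G e) (e ∷ [])
  cons   : ∀ e {y es} → Walk G (Digraph.head G e) y es →
           Walk G (Digraph.tail G e) y (e ∷ es)

IsPath : (G : Digraph) → Fin (V G) → Fin (V G) → List (Fin (E G)) → Set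
IsPath G x y es = Walk G x y es × Unique es

internal : (G : Digraph) → List (Fin (E G)) → List (Fin (V G))
internal G []            = []
internal G (e ∷ [])      = []
internal G (e ∷ f ∷ es)  = Digraph.head G e ∷ internal G (f ∷ es)

record StrongImmersion (H G : Digraph) : Set where
  field
    φ        : Fin (V H) → Fin (V G)
    φ-inj    : Injective _≡_ _≡_ φ
    path     : Fin (E H) → List (Fin (E G))
    path-ok  : ∀ e → IsPath G (φ (Digraph.tail H e)) (φ (Digraph.head H e)) (path e)
    disjoint : ∀ e e' → e ≢ e' → ∀ f → f ∈ path e → f ∉ path e'
    strong   : ∀ u e → φ u ∉ internal G (path e)

-- Treewidth (of the underlying undirected graph) at most k.
-- The tree has nodes Fin (suc t); node (fsuc i) is joined to its
-- parent (parent i), whose index is ≤ i (every finite tree arises so).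

record TreeDecomposition (G : Digraph) (k : ℕ) : Set where
  field
    t        : ℕ
    parent   : Fin t → Fin (suc t)
    parent-< : ∀ i → toℕ (parent i) ≤ toℕ i
    bag      : Fin (suc t) → List (Fin (V G))
  TreeEdge : Fin (suc t) → Fin (suc t) → Set
  TreeEdge x y = (∃[ i ] (x ≡ fsuc i × y ≡ parent i))
               ⊎ (∃[ i ] (y ≡ fsuc i × x ≡ parent i))
  StepIn : Fin (V G) → Fin (suc t) → Fin (suc t) → Set
  StepIn v x y = TreeEdge x y × v ∈ bag y
  field
    width     : ∀ x → length (bag x) ≤ suc k
    cover-v   : ∀ v → ∃[ x ] (v ∈ bag x)
    cover-e   : ∀ e → ∃[ x ] (Digraph.tail G e ∈ bag x × Digraph.head G e ∈ bag x)
    connected : ∀ v x y → v ∈ bag x → v ∈ bag y → Star (StepIn v) x y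

TreewidthAtMost : ℕ → Digraph → Set
TreewidthAtMost k G = TreeDecomposition G k

-- Planarity via combinatorial maps (rotation systems) of genus 0.
-- Darts: (e , true) is the dart of e at its tail, (e , false) at its head.

Dart : Digraph → Set
Dart G = Fin (E G) × Bool

dartVertex : (G : Digraph) → Dart G → Fin (V G)
dartVertex G (e , true)  = Digraph.tail G e
dartVertex G (e , false) = Digraph.head G e

flip : (G : Digraph) → Dart G → Dart G
flip G (e , b) = e , not b

iter : {A : Set} → (A → A) → ℕ → A → A
iter f zero    x = x
iter f (suc n) x = f (iter f n x)

SameOrbit : {A : Set} → (A → A) → A → A → Set
SameOrbit f x y = ∃[ n ] (iter f n x ≡ y)

-- R has exactly n equivalence classes: a surjection onto Fin n whose
-- fibres are exactly the R-classes.
NumClasses : {A : Set} → (A → A → Set) → ℕ → Set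
NumClasses {A} R n =
  Σ (A → Fin n) λ c → Surjective _≡_ _≡_ c ×
    (∀ x y → (c x ≡ c y → R x y) × (R x y → c x ≡ c y))

-- a rotation system: a permutation of darts whose cycles are exactly
-- the sets of darts at each (non-isolated) vertex
record RotationSystem (G : Digraph) : Set where
  field
    σ        : Dart G ↔ Dart G
  rot : Dart G → Dart G
  rot = Inverse.to σ
  field
    rot-vertex : ∀ d → dartVertex G (rot d) ≡ dartVertex G d
    rot-trans  : ∀ d d' → dartVertex G d ≡ dartVertex G d' → SameOrbit rot d d'

facePerm : (G : Digraph) → RotationSystem G → Dart G → Dart G
facePerm G ρ = RotationSystem.rot ρ ∘ flip G

MapStep : (G : Digraph) → RotationSystem G → Dart G → Dart G → Set
MapStep G ρ x y = (y ≡ RotationSystem.rot ρ x) ⊎ (y ≡ flip G x)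

-- Euler's formula V' - E + F = 2c (V' = non-isolated vertices = cycles
-- of the rotation, F = faces, c = connected components with an edge);
-- for every rotation system V' - E + F ≤ 2c, with equality iff each
-- component is embedded in the sphere.
Planar : Digraph → Set
Planar G = Σ (RotationSystem G) λ ρ → ∃[ nv ] ∃[ nf ] ∃[ nc ]
  ( NumClasses (SameOrbit (RotationSystem.rot ρ)) nv
  × NumClasses (SameOrbit (facePerm G ρ)) nf
  × NumClasses (Star (MapStep G ρ)) nc
  × nv + nf ≡ E G + 2 * nc )

InClass : ℕ → Digraph → Set
InClass k G = Eulerian G × Planar G × TreewidthAtMost k G

-- The sequence is the alternating wheels W (i + 1), where W n is a cycle of length 2(n + 1)
-- with alternating orientation plus a hub, joined by two parallel edges to every source and
-- from every sink of the cycle. W n is Eulerian, planar, and has a path decomposition of width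
-- 3 whose bags are the hub, one fixed rim vertex and two consecutive rim vertices.
-- In a strong immersion of W (a + 1) into W b the hub must go to the hub: three edges leave it,
-- and their paths start with distinct edges, while a rim vertex has out-degree two. A path
-- between rim vertices with no internal hub is then a single rim edge, because the only edges
-- leaving a sink of the rim go to the hub. So the vertex map is an injection sending rim edges
-- to rim edges, and as every rim vertex has just two rim neighbours, its image is closed under
-- rim adjacency, hence everything; comparing vertex counts gives b ≤ a + 1.

module Submission where

open import Defs
open import Data.Bool using (Bool; true; false; not)
open import Data.Empty using (⊥; ⊥-elim)
open import Data.Fin using (Fin; toℕ; fromℕ; inject₁) renaming (zero to fzero; suc to fsuc)
open import Data.Fin.Patterns using (0F; 1F; 2F; 3F; 4F; 5F)
import Data.Fin.Properties as Fin
open import Data.Fin.Properties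
  using (toℕ-inject₁; toℕ-fromℕ; toℕ≤n; toℕ-injective; toℕ-combine; injective⇒≤; *↔×; +↔⊎; 1↔⊤; 2↔Bool)
  renaming (_≟_ to _≟ᶠ_)
open import Data.List using (List; []; _∷_; length; map; filter; allFin)
open import Data.List.Properties using (length-map)
open import Data.List.Membership.Propositional using (_∈_; _∉_)
open import Data.List.Membership.Propositional.Properties using (∈-filter⁺; ∈-filter⁻; ∈-map⁺; ∈-map⁻; ∈-allFin)
open import Data.List.Membership.Propositional.Properties.WithK using (unique∧set⇒bag)
open import Data.List.Relation.Binary.BagAndSetEquality using (∼bag⇒↭)
open import Data.List.Relation.Binary.Permutation.Propositional using (_↭_)
open import Data.List.Relation.Binary.Permutation.Propositional.Properties using (↭-length)
open import Data.List.Relation.Unary.Any using (here; there)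
import Data.List.Relation.Unary.Unique.Propositional.Properties as Unique
open import Data.Nat using (ℕ; zero; suc; _+_; _*_; _∸_; _≤_; _<_; s≤s; s≤s⁻¹)
open import Data.Nat.Properties using (m∸n+n≡m; *-cancelʳ-≤; ≤-reflexive; <-irrefl; <-≤-trans; suc-injective)
open import Data.Nat.Tactic.RingSolver using (solve-∀)
open import Data.Product using (Σ; ∃; ∃-syntax; _×_; _,_; proj₁; proj₂)
open import Data.Product.Function.NonDependent.Propositional using (_×-↔_)
open import Data.Sum using (_⊎_; inj₁; inj₂)
open import Data.Sum.Function.Propositional using (_⊎-↔_)
open import Data.Unit using (⊤; tt)
open import Function.Base using (_∘′_)
open import Function.Bundles using (_↔_; Inverse; Injection; mk↔ₛ′; mk⇔)
open import Function.Construct.Composition using (_↔-∘_)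
open import Function.Construct.Identity using (↔-id)
open import Function.Construct.Symmetry using (↔-sym)
open import Function.Properties.Inverse using (↔⇒↣)
open import Relation.Binary.Construct.Closure.ReflexiveTransitive using (Star; ε; _◅_; _◅◅_; gmap)
open import Relation.Binary.PropositionalEquality
open import Relation.Nullary using (¬_; yes; no)

private variable
  A : Set
  n : ℕ

sucUnlessZero : Fin (suc n) → Fin (suc (suc n))
sucUnlessZero fzero    = fzero
sucUnlessZero (fsuc j) = fsuc (fsuc j)

-- i ↦ i + 1 (mod n + 1): the recursive call returns 0 exactly when i is the last index
next : Fin (suc n) → Fin (suc n)
next {zero}  fzero    = fzero
next {suc n} fzero    = fsuc fzero
next {suc n} (fsuc i) = sucUnlessZero (next i)

prev : Fin (suc n) → Fin (suc n)
prev {n}     fzero    = fromℕ n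
prev {suc n} (fsuc i) = inject₁ i

next-inject₁ : (i : Fin n) → next (inject₁ i) ≡ fsuc i
next-inject₁ {suc n} fzero    = refl
next-inject₁ {suc n} (fsuc i) = cong sucUnlessZero (next-inject₁ i)

next-fromℕ : ∀ n → next (fromℕ n) ≡ fzero
next-fromℕ zero    = refl
next-fromℕ (suc n) = cong sucUnlessZero (next-fromℕ n)

next-prev : (j : Fin (suc n)) → next (prev j) ≡ j
next-prev {n}     fzero    = next-fromℕ n
next-prev {suc n} (fsuc i) = next-inject₁ i

prev-fsuc : (k : Fin n) → prev (fsuc k) ≡ inject₁ k
prev-fsuc {suc n} k = refl

next≡0⇒last : (i : Fin (suc n)) → next i ≡ fzero → i ≡ fromℕ n
next≡0⇒last {zero}  fzero    _  = refl
next≡0⇒last {suc n} (fsuc i) eq with next i in e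
... | fzero = cong fsuc (next≡0⇒last i e)

prev-next : (j : Fin (suc n)) → prev (next j) ≡ j
prev-next {zero}  fzero    = refl
prev-next {suc n} fzero    = refl
prev-next {suc n} (fsuc i) with next i in e
... | fzero  = sym (cong fsuc (next≡0⇒last i e))
... | fsuc k = cong fsuc (trans (sym (prev-fsuc k)) (trans (sym (cong prev e)) (prev-next i)))

next≢id : (j : Fin (suc (suc n))) → next j ≢ j
next≢id {n}     (fsuc i) eq with next i in e
next≢id {suc n} (fsuc i) eq | fsuc k = next≢id i (trans e (Fin.suc-injective eq))

prev≢id : (j : Fin (suc (suc n))) → prev j ≢ j
prev≢id j eq = next≢id j (trans (cong next (sym eq)) (next-prev j))

suc-toℕ-prev : (j : Fin (suc n)) → j ≢ fzero → suc (toℕ (prev j)) ≡ toℕ j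
suc-toℕ-prev fzero            j≢0 = ⊥-elim (j≢0 refl)
suc-toℕ-prev {suc n} (fsuc i) _   = cong suc (toℕ-inject₁ i)

iter-next-zero : ∀ m (j : Fin (suc n)) → toℕ j ≡ m → iter next m fzero ≡ j
iter-next-zero zero    fzero    _  = refl
iter-next-zero {suc n} (suc m) (fsuc j) eq =
  trans (cong next (iter-next-zero m (inject₁ j) (trans (toℕ-inject₁ j) (suc-injective eq))))
        (next-inject₁ j)

iter-+ : (f : A → A) → ∀ m k x → iter f (m + k) x ≡ iter f m (iter f k x)
iter-+ f zero    k x = refl
iter-+ f (suc m) k x = cong f (iter-+ f m k x)

module Orbits {f : A → A} where

  SameOrbit-trans : ∀ {x y z} → SameOrbit f x y → SameOrbit f y z → SameOrbit f x z
  SameOrbit-trans {x} (m , refl) (k , refl) = k + m , iter-+ f k m x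

  SameOrbit-invariant : {B : Set} (h : A → B) → (∀ x → h (f x) ≡ h x) →
                        ∀ {x y} → SameOrbit f x y → h x ≡ h y
  SameOrbit-invariant h h-f (zero  , refl) = refl
  SameOrbit-invariant h h-f (suc m , refl) = trans (SameOrbit-invariant h h-f (m , refl)) (sym (h-f _))

  SameOrbit-cycle : (g : Fin (suc n) → A) (c : ℕ) → (∀ j → iter f c (g j) ≡ g (next j)) →
                    ∀ i j → SameOrbit f (g i) (g j)
  SameOrbit-cycle {n} g c g-next i j = SameOrbit-trans (to-start i) (from-start j)
    where
    along : ∀ m i → iter f (m * c) (g i) ≡ g (iter next m i)
    along zero    i = refl
    along (suc m) i = trans (iter-+ f c (m * c) (g i)) (trans (cong (iter f c) (along m i)) (g-next _))

    from-start : ∀ j → SameOrbit f (g fzero) (g j)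
    from-start j = toℕ j * c , trans (along (toℕ j) fzero) (cong g (iter-next-zero (toℕ j) j refl))

    to-start : ∀ i → SameOrbit f (g i) (g fzero)
    to-start i = k * c , trans (along k i) (cong g wraps)
      where
      k : ℕ
      k = suc n ∸ toℕ i

      wraps : iter next k i ≡ fzero
      wraps = begin
        iter next k i                          ≡⟨ cong (iter next k) (iter-next-zero (toℕ i) i refl) ⟨
        iter next k (iter next (toℕ i) fzero)  ≡⟨ iter-+ next k (toℕ i) fzero ⟨
        iter next (k + toℕ i) fzero            ≡⟨ cong (λ m → iter next m fzero) (m∸n+n≡m (toℕ≤n i)) ⟩
        iter next (suc n) fzero                ≡⟨ cong next (iter-next-zero n (fromℕ n) (toℕ-fromℕ n)) ⟩
        next (fromℕ n)                         ≡⟨ next-fromℕ n ⟩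
        fzero                                  ∎
        where open ≡-Reasoning

iter-conjugate : {B : Set} (κ : A ↔ B) (f : A → A) → ∀ m x →
  iter (Inverse.to κ ∘′ f ∘′ Inverse.from κ) m (Inverse.to κ x) ≡ Inverse.to κ (iter f m x)
iter-conjugate κ f zero    x = refl
iter-conjugate κ f (suc m) x =
  trans (cong (Inverse.to κ ∘′ f ∘′ Inverse.from κ) (iter-conjugate κ f m x))
        (cong (Inverse.to κ ∘′ f) (Inverse.strictlyInverseʳ κ (iter f m x)))

SameOrbit-conjugate : {B : Set} (κ : A ↔ B) {f : A → A} → ∀ {x y} →
  SameOrbit f (Inverse.from κ x) (Inverse.from κ y) → SameOrbit (Inverse.to κ ∘′ f ∘′ Inverse.from κ) x y
SameOrbit-conjugate {B = B} κ {f} {x} {y} (m , eq) = m ,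
  (begin
    iter f′ m x                         ≡⟨ cong (iter f′ m) (strictlyInverseˡ x) ⟨
    iter f′ m (to (from x))             ≡⟨ iter-conjugate κ f m (from x) ⟩
    to (iter f m (from x))              ≡⟨ cong to eq ⟩
    to (from y)                         ≡⟨ strictlyInverseˡ y ⟩
    y                                   ∎)
  where
  open ≡-Reasoning
  open Inverse κ using (to; from; strictlyInverseˡ)
  f′ : B → B
  f′ = to ∘′ f ∘′ from

open Orbits

next-transitive : ∀ (i j : Fin (suc n)) → SameOrbit next i j
next-transitive = SameOrbit-cycle (λ j → j) 1 (λ j → refl)

-- π maps the edges leaving v bijectively onto the edges entering v
eulerian-byBijection : (G : Digraph) (π : Fin (E G) ↔ Fin (E G)) →
  (∀ e → Digraph.head G (Inverse.to π e) ≡ Digraph.tail G e) → Eulerian G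
eulerian-byBijection G π head-π v = trans (sym (↭-length leaving↭entering)) (length-map to leaving)
  where
  open Inverse π using (to; from; strictlyInverseˡ)
  leaving entering : List (Fin (E G))
  leaving  = filter (λ e → Digraph.tail G e ≟ᶠ v) (allFin (E G))
  entering = filter (λ e → Digraph.head G e ≟ᶠ v) (allFin (E G))

  into : ∀ {e} → e ∈ map to leaving → e ∈ entering
  into e∈ with ∈-map⁻ to e∈
  ... | e , e∈leaving , refl = ∈-filter⁺ (λ e → Digraph.head G e ≟ᶠ v) (∈-allFin (to e))
          (trans (head-π e) (proj₂ (∈-filter⁻ (λ e → Digraph.tail G e ≟ᶠ v) {xs = allFin (E G)} e∈leaving)))

  onto : ∀ {e} → e ∈ entering → e ∈ map to leaving
  onto {e} e∈ = subst (_∈ map to leaving) (strictlyInverseˡ e)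
    (∈-map⁺ to (∈-filter⁺ (λ e → Digraph.tail G e ≟ᶠ v) (∈-allFin (from e))
      (trans (sym (head-π (from e)))
        (trans (cong (Digraph.head G) (strictlyInverseˡ e))
               (proj₂ (∈-filter⁻ (λ e → Digraph.head G e ≟ᶠ v) {xs = allFin (E G)} e∈))))))

  leaving↭entering : map to leaving ↭ entering
  leaving↭entering = ∼bag⇒↭ (unique∧set⇒bag
    (Unique.map⁺ (Injection.injective (↔⇒↣ π)) (Unique.filter⁺ _ (Unique.allFin⁺ (E G))))
    (Unique.filter⁺ _ (Unique.allFin⁺ (E G)))
    (mk⇔ into onto))

module Presented {Vertex Edge : Set} {nv ne : ℕ} (vertexEnum : Vertex ↔ Fin nv) (edgeEnum : Edge ↔ Fin ne)
                 (source target : Edge → Vertex) where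

  open Inverse vertexEnum public using () renaming
    (to to encV; from to decV; strictlyInverseˡ to encV-decV; strictlyInverseʳ to decV-encV)
  open Inverse edgeEnum public using () renaming
    (to to encE; from to decE; strictlyInverseˡ to encE-decE; strictlyInverseʳ to decE-encE)

  digraph : Digraph
  digraph = record
    { V = nv ; E = ne ; tail = λ e → encV (source (decE e)) ; head = λ e → encV (target (decE e)) }

  encV-injective : ∀ {x y} → encV x ≡ encV y → x ≡ y
  encV-injective {x} {y} eq = trans (sym (decV-encV x)) (trans (cong decV eq) (decV-encV y))

  encE-injective : ∀ {x y} → encE x ≡ encE y → x ≡ y
  encE-injective {x} {y} eq = trans (sym (decE-encE x)) (trans (cong decE eq) (decE-encE y))

  decE-injective : ∀ {e f} → decE e ≡ decE f → e ≡ f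
  decE-injective {e} {f} eq = trans (sym (encE-decE e)) (trans (cong encE eq) (encE-decE f))

  tail-encE : ∀ e → Digraph.tail digraph (encE e) ≡ encV (source e)
  tail-encE e = cong (encV ∘′ source) (decE-encE e)

  head-encE : ∀ e → Digraph.head digraph (encE e) ≡ encV (target e)
  head-encE e = cong (encV ∘′ target) (decE-encE e)

  eulerian : (π : Edge ↔ Edge) → (∀ e → target (Inverse.to π e) ≡ source e) → Eulerian digraph
  eulerian π target-π = eulerian-byBijection digraph (edgeEnum ↔-∘ (π ↔-∘ ↔-sym edgeEnum))
    (λ e → trans (head-encE _) (cong encV (target-π (decE e))))

  EdgeEnd : Set
  EdgeEnd = Edge × Bool

  endVertex : EdgeEnd → Vertex
  endVertex (e , true)  = source e
  endVertex (e , false) = target e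

  opposite : EdgeEnd → EdgeEnd
  opposite (e , b) = e , not b

  dartEnum : EdgeEnd ↔ Dart digraph
  dartEnum = mk↔ₛ′ (λ (e , b) → encE e , b) (λ (e , b) → decE e , b)
    (λ (e , b) → cong (_, b) (encE-decE e)) (λ (e , b) → cong (_, b) (decE-encE e))

  open Inverse dartEnum using () renaming (to to encD; from to decD; strictlyInverseˡ to encD-decD)

  dartVertex-encD : ∀ d → dartVertex digraph (encD d) ≡ encV (endVertex d)
  dartVertex-encD (e , true)  = tail-encE e
  dartVertex-encD (e , false) = head-encE e

  dartVertex-decD : ∀ d → dartVertex digraph d ≡ encV (endVertex (decD d))
  dartVertex-decD (e , true)  = refl
  dartVertex-decD (e , false) = refl

  record SphericalMap : Set₁ where
    field
      rotation : EdgeEnd ↔ EdgeEnd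
    rotate : EdgeEnd → EdgeEnd
    rotate = Inverse.to rotation
    faceStep : EdgeEnd → EdgeEnd
    faceStep = rotate ∘′ opposite
    field
      rotate-vertex     : ∀ d → endVertex (rotate d) ≡ endVertex d
      rotate-transitive : ∀ d d' → endVertex d ≡ endVertex d' → SameOrbit rotate d d'
      endAt             : Vertex → EdgeEnd
      endVertex-endAt   : ∀ v → endVertex (endAt v) ≡ v
      Face              : Set
      nf                : ℕ
      faceEnum          : Face ↔ Fin nf
      faceOf            : EdgeEnd → Face
      faceOf-step       : ∀ d → faceOf (faceStep d) ≡ faceOf d
      faceOf-transitive : ∀ d d' → faceOf d ≡ faceOf d' → SameOrbit faceStep d d'
      endOn             : Face → EdgeEnd
      faceOf-endOn      : ∀ f → faceOf (endOn f) ≡ f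
      base              : EdgeEnd    -- the single component is inhabited
      connected         : ∀ d d' → Star (λ x y → y ≡ rotate x ⊎ y ≡ opposite x) d d'
      euler             : nv + nf ≡ ne + 2

  module _ (M : SphericalMap) where
    open SphericalMap M
    open Inverse faceEnum using () renaming
      (to to encF; from to decF; strictlyInverseˡ to encF-decF; strictlyInverseʳ to decF-encF)

    rotationSystem : RotationSystem digraph
    rotationSystem = record
      { σ = dartEnum ↔-∘ (rotation ↔-∘ ↔-sym dartEnum) ; rot-vertex = rot-vertex ; rot-trans = vertexOrbit }
      where
      rot-vertex : ∀ d → dartVertex digraph (encD (rotate (decD d))) ≡ dartVertex digraph d
      rot-vertex d = trans (dartVertex-encD (rotate (decD d)))
                           (trans (cong encV (rotate-vertex (decD d))) (sym (dartVertex-decD d)))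

      vertexOrbit : ∀ d d' → dartVertex digraph d ≡ dartVertex digraph d' →
                    SameOrbit (encD ∘′ rotate ∘′ decD) d d'
      vertexOrbit d d' eq = SameOrbit-conjugate dartEnum (rotate-transitive (decD d) (decD d')
        (encV-injective (trans (sym (dartVertex-decD d)) (trans eq (dartVertex-decD d')))))

    open RotationSystem rotationSystem using (rot; rot-vertex; rot-trans)

    vertexClasses : NumClasses (SameOrbit rot) nv
    vertexClasses = dartVertex digraph , onto , λ d d' → rot-trans d d' , SameOrbit-invariant (dartVertex digraph) rot-vertex
      where
      onto : ∀ v → ∃ λ d → ∀ {d'} → d' ≡ d → dartVertex digraph d' ≡ v
      onto v = encD (endAt (decV v)) , λ { refl →
        trans (dartVertex-encD (endAt (decV v))) (trans (cong encV (endVertex-endAt _)) (encV-decV v)) }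

    faceClass : Dart digraph → Fin nf
    faceClass d = encF (faceOf (decD d))

    faceClass-step : ∀ d → faceClass (facePerm digraph rotationSystem d) ≡ faceClass d
    faceClass-step d = trans (cong (encF ∘′ faceOf) (Inverse.strictlyInverseʳ dartEnum _)) (cong encF (faceOf-step (decD d)))

    faceClasses : NumClasses (SameOrbit (facePerm digraph rotationSystem)) nf
    faceClasses = faceClass , onto , λ d d' → faceOrbit d d' , SameOrbit-invariant faceClass faceClass-step
      where
      onto : ∀ f → ∃ λ d → ∀ {d'} → d' ≡ d → faceClass d' ≡ f
      onto f = encD (endOn (decF f)) , λ { refl → trans (cong (encF ∘′ faceOf) (Inverse.strictlyInverseʳ dartEnum _))
                                                       (trans (cong encF (faceOf-endOn _)) (encF-decF f)) }

      faceOrbit : ∀ d d' → faceClass d ≡ faceClass d' → SameOrbit (facePerm digraph rotationSystem) d d'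
      faceOrbit d d' eq = SameOrbit-conjugate dartEnum
        (faceOf-transitive (decD d) (decD d') (trans (sym (decF-encF _)) (trans (cong decF eq) (decF-encF _))))

    componentClasses : NumClasses (Star (MapStep digraph rotationSystem)) 1
    componentClasses = (λ _ → fzero) , (λ { fzero → encD base , λ _ → refl }) ,
      λ d d' → (λ _ → subst₂ (Star (MapStep digraph rotationSystem)) (encD-decD d) (encD-decD d')
                               (gmap encD lift-step (connected (decD d) (decD d')))) ,
               (λ _ → refl)
      where
      lift-step : ∀ {x y} → y ≡ rotate x ⊎ y ≡ opposite x → MapStep digraph rotationSystem (encD x) (encD y)
      lift-step (inj₁ refl) = inj₁ (cong (encD ∘′ rotate) (sym (Inverse.strictlyInverseʳ dartEnum _)))
      lift-step (inj₂ refl) = inj₂ refl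

    planar : Planar digraph
    planar = rotationSystem , nv , nf , 1 , vertexClasses , faceClasses , componentClasses , euler

indexedEnum : {K : Set} {k : ℕ} → K ↔ Fin k → (Fin n × K) ↔ Fin (n * k)
indexedEnum κ = ↔-sym *↔× ↔-∘ (↔-id _ ×-↔ κ)

pointedEnum : {m : ℕ} → A ↔ Fin m → (⊤ ⊎ A) ↔ Fin (suc m)
pointedEnum α = ↔-sym +↔⊎ ↔-∘ (↔-sym 1↔⊤ ⊎-↔ α)

-- even j and odd j sit at positions 2j and 2j + 1 of the rim cycle
Vertex : ℕ → Set
Vertex n = ⊤ ⊎ (Fin (suc n) × Bool)

pattern hub    = inj₁ tt
pattern even j = inj₂ (j , false)
pattern odd j  = inj₂ (j , true)

data Kind : Set where
  left right down₁ down₂ up₁ up₂ : Kind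

Edge : ℕ → Set
Edge n = Fin (suc n) × Kind

source target : Edge n → Vertex n
source (j , left)  = even j
source (j , right) = even (next j)
source (j , down₁) = hub
source (j , down₂) = hub
source (j , up₁)   = odd j
source (j , up₂)   = odd j
target (j , left)  = odd j
target (j , right) = odd j
target (j , down₁) = even j
target (j , down₂) = even j
target (j , up₁)   = hub
target (j , up₂)   = hub

kindEnum : Kind ↔ Fin 6
kindEnum = mk↔ₛ′ to from to-from from-to
  where
  to : Kind → Fin 6
  to left  = 0F
  to right = 1F
  to down₁ = 2F
  to down₂ = 3F
  to up₁   = 4F
  to up₂   = 5F
  from : Fin 6 → Kind
  from 0F = left
  from 1F = right
  from 2F = down₁
  from 3F = down₂
  from 4F = up₁
  from 5F = up₂
  to-from : ∀ i → to (from i) ≡ i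
  to-from 0F = refl
  to-from 1F = refl
  to-from 2F = refl
  to-from 3F = refl
  to-from 4F = refl
  to-from 5F = refl
  from-to : ∀ k → from (to k) ≡ k
  from-to left  = refl
  from-to right = refl
  from-to down₁ = refl
  from-to down₂ = refl
  from-to up₁   = refl
  from-to up₂   = refl

module Wheel (n : ℕ) =
  Presented {Vertex n} {Edge n} (pointedEnum (indexedEnum (↔-sym 2↔Bool))) (indexedEnum kindEnum) source target

wheel : ℕ → Digraph
wheel n = Wheel.digraph n

entering : Edge n ↔ Edge n
entering = mk↔ₛ′ to from to-from from-to
  where
  to from : Edge n → Edge n
  to (j , left)  = j , down₁
  to (j , right) = next j , down₂
  to (j , down₁) = j , up₁
  to (j , down₂) = j , up₂
  to (j , up₁)   = j , left
  to (j , up₂)   = j , right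
  from (j , down₁) = j , left
  from (j , down₂) = prev j , right
  from (j , up₁)   = j , down₁
  from (j , up₂)   = j , down₂
  from (j , left)  = j , up₁
  from (j , right) = j , up₂
  to-from : ∀ e → to (from e) ≡ e
  to-from (j , left)  = refl
  to-from (j , right) = refl
  to-from (j , down₁) = refl
  to-from (j , down₂) = cong (_, down₂) (next-prev j)
  to-from (j , up₁)   = refl
  to-from (j , up₂)   = refl
  from-to : ∀ e → from (to e) ≡ e
  from-to (j , left)  = refl
  from-to (j , right) = cong (_, right) (prev-next j)
  from-to (j , down₁) = refl
  from-to (j , down₂) = refl
  from-to (j , up₁)   = refl
  from-to (j , up₂)   = refl

target-entering : (e : Edge n) → target (Inverse.to entering e) ≡ source e
target-entering (j , left)  = refl
target-entering (j , right) = refl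
target-entering (j , down₁) = refl
target-entering (j , down₂) = refl
target-entering (j , up₁)   = refl
target-entering (j , up₂)   = refl

wheel-eulerian : ∀ n → Eulerian (wheel n)
wheel-eulerian n = Wheel.eulerian n entering target-entering

-- besides the outer face (the rim cycle), each index j bounds two digons of parallel
-- spokes and two triangles hub – rim – rim
data FaceKind : Set where
  downDigon upDigon leftTriangle rightTriangle : FaceKind

faceKindEnum : FaceKind ↔ Fin 4
faceKindEnum = mk↔ₛ′ to from to-from from-to
  where
  to : FaceKind → Fin 4
  to downDigon     = 0F
  to upDigon       = 1F
  to leftTriangle  = 2F
  to rightTriangle = 3F
  from : Fin 4 → FaceKind
  from 0F = downDigon
  from 1F = upDigon
  from 2F = leftTriangle
  from 3F = rightTriangle
  to-from : ∀ i → to (from i) ≡ i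
  to-from 0F = refl
  to-from 1F = refl
  to-from 2F = refl
  to-from 3F = refl
  from-to : ∀ k → from (to k) ≡ k
  from-to downDigon     = refl
  from-to upDigon       = refl
  from-to leftTriangle  = refl
  from-to rightTriangle = refl

module _ {n : ℕ} where
  open Wheel n using (EdgeEnd; endVertex; opposite)

  -- cyclic orders: at even j  left, down₁, down₂, right of prev j;  at odd j  right, up₁, up₂, left;
  -- at the hub  down₂, down₁, up₂, up₁ of j, then of next j
  rotate rotate⁻ : EdgeEnd → EdgeEnd
  rotate ((j , left)  , true)  = (j , down₁) , false
  rotate ((j , down₁) , false) = (j , down₂) , false
  rotate ((j , down₂) , false) = (prev j , right) , true
  rotate ((j , right) , true)  = (next j , left) , true
  rotate ((j , right) , false) = (j , up₁) , true
  rotate ((j , up₁)   , true)  = (j , up₂) , true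
  rotate ((j , up₂)   , true)  = (j , left) , false
  rotate ((j , left)  , false) = (j , right) , false
  rotate ((j , down₂) , true)  = (j , down₁) , true
  rotate ((j , down₁) , true)  = (j , up₂) , false
  rotate ((j , up₂)   , false) = (j , up₁) , false
  rotate ((j , up₁)   , false) = (next j , down₂) , true
  rotate⁻ ((j , down₁) , false) = (j , left) , true
  rotate⁻ ((j , down₂) , false) = (j , down₁) , false
  rotate⁻ ((j , right) , true)  = (next j , down₂) , false
  rotate⁻ ((j , left)  , true)  = (prev j , right) , true
  rotate⁻ ((j , up₁)   , true)  = (j , right) , false
  rotate⁻ ((j , up₂)   , true)  = (j , up₁) , true
  rotate⁻ ((j , left)  , false) = (j , up₂) , true
  rotate⁻ ((j , right) , false) = (j , left) , false
  rotate⁻ ((j , down₁) , true)  = (j , down₂) , true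
  rotate⁻ ((j , up₂)   , false) = (j , down₁) , true
  rotate⁻ ((j , up₁)   , false) = (j , up₂) , false
  rotate⁻ ((j , down₂) , true)  = (prev j , up₁) , false

  rotation : EdgeEnd ↔ EdgeEnd
  rotation = mk↔ₛ′ rotate rotate⁻ rotate-rotate⁻ rotate⁻-rotate
    where
    rotate-rotate⁻ : ∀ d → rotate (rotate⁻ d) ≡ d
    rotate-rotate⁻ ((j , down₁) , false) = refl
    rotate-rotate⁻ ((j , down₂) , false) = refl
    rotate-rotate⁻ ((j , right) , true)  = cong (λ i → (i , right) , true) (prev-next j)
    rotate-rotate⁻ ((j , left)  , true)  = cong (λ i → (i , left) , true) (next-prev j)
    rotate-rotate⁻ ((j , up₁)   , true)  = refl
    rotate-rotate⁻ ((j , up₂)   , true)  = refl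
    rotate-rotate⁻ ((j , left)  , false) = refl
    rotate-rotate⁻ ((j , right) , false) = refl
    rotate-rotate⁻ ((j , down₁) , true)  = refl
    rotate-rotate⁻ ((j , up₂)   , false) = refl
    rotate-rotate⁻ ((j , up₁)   , false) = refl
    rotate-rotate⁻ ((j , down₂) , true)  = cong (λ i → (i , down₂) , true) (next-prev j)
    rotate⁻-rotate : ∀ d → rotate⁻ (rotate d) ≡ d
    rotate⁻-rotate ((j , left)  , true)  = refl
    rotate⁻-rotate ((j , down₁) , false) = refl
    rotate⁻-rotate ((j , down₂) , false) = cong (λ i → (i , down₂) , false) (next-prev j)
    rotate⁻-rotate ((j , right) , true)  = cong (λ i → (i , right) , true) (prev-next j)
    rotate⁻-rotate ((j , right) , false) = refl
    rotate⁻-rotate ((j , up₁)   , true)  = refl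
    rotate⁻-rotate ((j , up₂)   , true)  = refl
    rotate⁻-rotate ((j , left)  , false) = refl
    rotate⁻-rotate ((j , down₂) , true)  = refl
    rotate⁻-rotate ((j , down₁) , true)  = refl
    rotate⁻-rotate ((j , up₂)   , false) = refl
    rotate⁻-rotate ((j , up₁)   , false) = cong (λ i → (i , up₁) , false) (prev-next j)

  endVertex-rotate : ∀ d → endVertex (rotate d) ≡ endVertex d
  endVertex-rotate ((j , left)  , true)  = refl
  endVertex-rotate ((j , down₁) , false) = refl
  endVertex-rotate ((j , down₂) , false) = cong even (next-prev j)
  endVertex-rotate ((j , right) , true)  = refl
  endVertex-rotate ((j , right) , false) = refl
  endVertex-rotate ((j , up₁)   , true)  = refl
  endVertex-rotate ((j , up₂)   , true)  = refl
  endVertex-rotate ((j , left)  , false) = refl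
  endVertex-rotate ((j , down₂) , true)  = refl
  endVertex-rotate ((j , down₁) , true)  = refl
  endVertex-rotate ((j , up₂)   , false) = refl
  endVertex-rotate ((j , up₁)   , false) = refl

  endAt : Vertex n → EdgeEnd
  endAt hub      = (fzero , down₂) , true
  endAt (even j) = (j , left) , true
  endAt (odd j)  = (j , right) , false

  endVertex-endAt : ∀ v → endVertex (endAt v) ≡ v
  endVertex-endAt hub      = refl
  endVertex-endAt (even j) = refl
  endVertex-endAt (odd j)  = refl

  hubEnds-orbit : ∀ i j → SameOrbit rotate ((i , down₂) , true) ((j , down₂) , true)
  hubEnds-orbit = SameOrbit-cycle (λ j → (j , down₂) , true) 4 (λ j → refl)

  toEndAt : ∀ d → SameOrbit rotate d (endAt (endVertex d))
  toEndAt ((j , left)  , true)  = 0 , refl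
  toEndAt ((j , down₁) , false) = 3 , cong (λ i → (i , left) , true) (next-prev j)
  toEndAt ((j , down₂) , false) = 2 , cong (λ i → (i , left) , true) (next-prev j)
  toEndAt ((j , right) , true)  = 1 , refl
  toEndAt ((j , right) , false) = 0 , refl
  toEndAt ((j , up₁)   , true)  = 3 , refl
  toEndAt ((j , up₂)   , true)  = 2 , refl
  toEndAt ((j , left)  , false) = 1 , refl
  toEndAt ((j , down₂) , true)  = hubEnds-orbit j fzero
  toEndAt ((j , down₁) , true)  = SameOrbit-trans (3 , refl) (hubEnds-orbit (next j) fzero)
  toEndAt ((j , up₂)   , false) = SameOrbit-trans (2 , refl) (hubEnds-orbit (next j) fzero)
  toEndAt ((j , up₁)   , false) = SameOrbit-trans (1 , refl) (hubEnds-orbit (next j) fzero)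

  fromEndAt : ∀ d → SameOrbit rotate (endAt (endVertex d)) d
  fromEndAt ((j , left)  , true)  = 0 , refl
  fromEndAt ((j , down₁) , false) = 1 , refl
  fromEndAt ((j , down₂) , false) = 2 , refl
  fromEndAt ((j , right) , true)  = 3 , cong (λ i → (i , right) , true) (prev-next j)
  fromEndAt ((j , right) , false) = 0 , refl
  fromEndAt ((j , up₁)   , true)  = 1 , refl
  fromEndAt ((j , up₂)   , true)  = 2 , refl
  fromEndAt ((j , left)  , false) = 3 , refl
  fromEndAt ((j , down₂) , true)  = hubEnds-orbit fzero j
  fromEndAt ((j , down₁) , true)  = SameOrbit-trans (hubEnds-orbit fzero j) (1 , refl)
  fromEndAt ((j , up₂)   , false) = SameOrbit-trans (hubEnds-orbit fzero j) (2 , refl)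
  fromEndAt ((j , up₁)   , false) = SameOrbit-trans (hubEnds-orbit fzero j) (3 , refl)

  rotate-transitive : ∀ d d' → endVertex d ≡ endVertex d' → SameOrbit rotate d d'
  rotate-transitive d d' eq = SameOrbit-trans (toEndAt d) (subst (λ v → SameOrbit rotate (endAt v) d') (sym eq) (fromEndAt d'))

  faceStep : EdgeEnd → EdgeEnd
  faceStep = rotate ∘′ opposite

  Face : Set
  Face = ⊤ ⊎ (Fin (suc n) × FaceKind)

  pattern outer     = inj₁ tt
  pattern inner j k = inj₂ (j , k)

  faceOf : EdgeEnd → Face
  faceOf ((j , left)  , true)  = outer
  faceOf ((j , right) , false) = outer
  faceOf ((j , down₁) , true)  = inner j downDigon
  faceOf ((j , down₂) , false) = inner j downDigon
  faceOf ((j , up₁)   , false) = inner j upDigon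
  faceOf ((j , up₂)   , true)  = inner j upDigon
  faceOf ((j , left)  , false) = inner j leftTriangle
  faceOf ((j , down₁) , false) = inner j leftTriangle
  faceOf ((j , up₂)   , false) = inner j leftTriangle
  faceOf ((j , right) , true)  = inner j rightTriangle
  faceOf ((j , up₁)   , true)  = inner j rightTriangle
  faceOf ((j , down₂) , true)  = inner (prev j) rightTriangle

  faceOf-step : ∀ d → faceOf (faceStep d) ≡ faceOf d
  faceOf-step ((j , left)  , true)  = refl
  faceOf-step ((j , right) , false) = refl
  faceOf-step ((j , down₁) , true)  = refl
  faceOf-step ((j , down₂) , false) = refl
  faceOf-step ((j , up₁)   , false) = refl
  faceOf-step ((j , up₂)   , true)  = refl
  faceOf-step ((j , left)  , false) = refl
  faceOf-step ((j , down₁) , false) = refl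
  faceOf-step ((j , up₂)   , false) = refl
  faceOf-step ((j , right) , true)  = refl
  faceOf-step ((j , up₁)   , true)  = cong (λ i → inner i rightTriangle) (prev-next j)
  faceOf-step ((j , down₂) , true)  = refl

  endOn : Face → EdgeEnd
  endOn outer                 = (fzero , left) , true
  endOn (inner j downDigon)     = (j , down₁) , true
  endOn (inner j upDigon)       = (j , up₁) , false
  endOn (inner j leftTriangle)  = (j , left) , false
  endOn (inner j rightTriangle) = (j , right) , true

  faceOf-endOn : ∀ f → faceOf (endOn f) ≡ f
  faceOf-endOn outer                   = refl
  faceOf-endOn (inner j downDigon)     = refl
  faceOf-endOn (inner j upDigon)       = refl
  faceOf-endOn (inner j leftTriangle)  = refl
  faceOf-endOn (inner j rightTriangle) = refl

  outerEnds-orbit : ∀ i j → SameOrbit faceStep ((i , left) , true) ((j , left) , true)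
  outerEnds-orbit = SameOrbit-cycle (λ j → (j , left) , true) 2 (λ j → refl)

  toEndOn : ∀ d → SameOrbit faceStep d (endOn (faceOf d))
  toEndOn ((j , left)  , true)  = outerEnds-orbit j fzero
  toEndOn ((j , right) , false) = SameOrbit-trans (1 , refl) (outerEnds-orbit (next j) fzero)
  toEndOn ((j , down₁) , true)  = 0 , refl
  toEndOn ((j , down₂) , false) = 1 , refl
  toEndOn ((j , up₁)   , false) = 0 , refl
  toEndOn ((j , up₂)   , true)  = 1 , refl
  toEndOn ((j , left)  , false) = 0 , refl
  toEndOn ((j , down₁) , false) = 2 , refl
  toEndOn ((j , up₂)   , false) = 1 , refl
  toEndOn ((j , right) , true)  = 0 , refl
  toEndOn ((j , up₁)   , true)  = 2 , cong (λ i → (i , right) , true) (prev-next j)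
  toEndOn ((j , down₂) , true)  = 1 , refl

  fromEndOn : ∀ d → SameOrbit faceStep (endOn (faceOf d)) d
  fromEndOn ((j , left)  , true)  = outerEnds-orbit fzero j
  fromEndOn ((j , right) , false) = SameOrbit-trans (outerEnds-orbit fzero j) (1 , refl)
  fromEndOn ((j , down₁) , true)  = 0 , refl
  fromEndOn ((j , down₂) , false) = 1 , refl
  fromEndOn ((j , up₁)   , false) = 0 , refl
  fromEndOn ((j , up₂)   , true)  = 1 , refl
  fromEndOn ((j , left)  , false) = 0 , refl
  fromEndOn ((j , down₁) , false) = 1 , refl
  fromEndOn ((j , up₂)   , false) = 2 , refl
  fromEndOn ((j , right) , true)  = 0 , refl
  fromEndOn ((j , up₁)   , true)  = 1 , refl
  fromEndOn ((j , down₂) , true)  = 2 , cong (λ i → (i , down₂) , true) (next-prev j)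

  faceOf-transitive : ∀ d d' → faceOf d ≡ faceOf d' → SameOrbit faceStep d d'
  faceOf-transitive d d' eq =
    SameOrbit-trans (toEndOn d) (subst (λ f → SameOrbit faceStep (endOn f) d') (sym eq) (fromEndOn d'))

  MapStep′ : EdgeEnd → EdgeEnd → Set
  MapStep′ x y = y ≡ rotate x ⊎ y ≡ opposite x

  orbit⇒steps : ∀ {d d'} → SameOrbit rotate d d' → Star MapStep′ d d'
  orbit⇒steps {d} (m , refl) = steps m
    where
    steps : ∀ m → Star MapStep′ d (iter rotate m d)
    steps zero    = ε
    steps (suc m) = steps m ◅◅ (inj₁ refl ◅ ε)

  toHub : ∀ d → Star MapStep′ d (endAt hub)
  toHub d with endVertex d in eq
  ... | hub    = orbit⇒steps (rotate-transitive d (endAt hub) eq)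
  ... | even j = orbit⇒steps (rotate-transitive d ((j , down₁) , false) eq)
                 ◅◅ inj₂ refl ◅ orbit⇒steps (rotate-transitive ((j , down₁) , true) (endAt hub) refl)
  ... | odd j  = orbit⇒steps (rotate-transitive d ((j , up₁) , true) eq)
                 ◅◅ inj₂ refl ◅ orbit⇒steps (rotate-transitive ((j , up₁) , false) (endAt hub) refl)

  fromHub : ∀ d → Star MapStep′ (endAt hub) d
  fromHub d with endVertex d in eq
  ... | hub    = orbit⇒steps (rotate-transitive (endAt hub) d (sym eq))
  ... | even j = orbit⇒steps (rotate-transitive (endAt hub) ((j , down₁) , true) refl)
                 ◅◅ inj₂ refl ◅ orbit⇒steps (rotate-transitive ((j , down₁) , false) d (sym eq))
  ... | odd j  = orbit⇒steps (rotate-transitive (endAt hub) ((j , up₁) , false) refl)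
                 ◅◅ inj₂ refl ◅ orbit⇒steps (rotate-transitive ((j , up₁) , true) d (sym eq))

  wheelMap : Wheel.SphericalMap n
  wheelMap = record
    { rotation          = rotation
    ; rotate-vertex     = endVertex-rotate
    ; rotate-transitive = rotate-transitive
    ; endAt             = endAt
    ; endVertex-endAt   = endVertex-endAt
    ; Face              = Face
    ; nf                = suc (suc n * 4)
    ; faceEnum          = pointedEnum (indexedEnum faceKindEnum)
    ; faceOf            = faceOf
    ; faceOf-step       = faceOf-step
    ; faceOf-transitive = faceOf-transitive
    ; endOn             = endOn
    ; faceOf-endOn      = faceOf-endOn
    ; base              = endAt hub
    ; connected         = λ d d' → toHub d ◅◅ fromHub d'
    ; euler             = euler n
    }
    where
    euler : ∀ n → suc (suc n * 2) + suc (suc n * 4) ≡ suc n * 6 + 2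
    euler = solve-∀

wheel-planar : ∀ n → Planar (wheel n)
wheel-planar n = Wheel.planar n wheelMap

module PathDecomposition (G : Digraph) {t : ℕ} (bag : Fin (suc t) → List (Fin (V G))) where

  -- node fsuc i hangs below inject₁ i, so the tree is the path 0 – 1 – ⋯ – t
  TreeEdge : Fin (suc t) → Fin (suc t) → Set
  TreeEdge x y = (∃[ i ] (x ≡ fsuc i × y ≡ inject₁ i)) ⊎ (∃[ i ] (y ≡ fsuc i × x ≡ inject₁ i))

  StepIn : Fin (V G) → Fin (suc t) → Fin (suc t) → Set
  StepIn v x y = TreeEdge x y × v ∈ bag y

  consecutive-adjacent : ∀ x y → toℕ y ≡ suc (toℕ x) → TreeEdge x y × TreeEdge y x
  consecutive-adjacent x (fsuc i) eq = inj₂ (i , refl , x≡) , inj₁ (i , refl , x≡)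
    where
    x≡ : x ≡ inject₁ i
    x≡ = toℕ-injective (trans (suc-injective (sym eq)) (sym (toℕ-inject₁ i)))

  module _ {v : Fin (V G)} (v∈ : ∀ x → v ∈ bag x) where

    toRoot : ∀ m x → toℕ x ≡ m → Star (StepIn v) x fzero
    toRoot zero    fzero    _  = ε
    toRoot (suc m) (fsuc i) eq =
      (inj₁ (i , refl , refl) , v∈ _) ◅ toRoot m (inject₁ i) (trans (toℕ-inject₁ i) (suc-injective eq))

    fromRoot : ∀ m x → toℕ x ≡ m → Star (StepIn v) fzero x
    fromRoot zero    fzero    _  = ε
    fromRoot (suc m) (fsuc i) eq =
      fromRoot m (inject₁ i) (trans (toℕ-inject₁ i) (suc-injective eq)) ◅◅ (inj₂ (i , refl , refl) , v∈ _) ◅ ε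

    connected-everywhere : ∀ x y → Star (StepIn v) x y
    connected-everywhere x y = toRoot _ x refl ◅◅ fromRoot _ y refl

  connected-consecutive : ∀ {v} u₁ u₂ → toℕ u₂ ≡ suc (toℕ u₁) → v ∈ bag u₁ → v ∈ bag u₂ →
    ∀ {x y} → (x ≡ u₁ ⊎ x ≡ u₂) → (y ≡ u₁ ⊎ y ≡ u₂) → Star (StepIn v) x y
  connected-consecutive u₁ u₂ eq v∈u₁ v∈u₂ (inj₁ refl) (inj₁ refl) = ε
  connected-consecutive u₁ u₂ eq v∈u₁ v∈u₂ (inj₂ refl) (inj₂ refl) = ε
  connected-consecutive u₁ u₂ eq v∈u₁ v∈u₂ (inj₁ refl) (inj₂ refl) =
    (proj₁ (consecutive-adjacent u₁ u₂ eq) , v∈u₂) ◅ ε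
  connected-consecutive u₁ u₂ eq v∈u₁ v∈u₂ (inj₂ refl) (inj₁ refl) =
    (proj₂ (consecutive-adjacent u₁ u₂ eq) , v∈u₁) ◅ ε

  data Spread (v : Fin (V G)) : Set where
    everywhere  : (∀ x → v ∈ bag x) → Spread v
    consecutive : ∀ u₁ u₂ → toℕ u₂ ≡ suc (toℕ u₁) → v ∈ bag u₁ → v ∈ bag u₂ →
                  (∀ x → v ∈ bag x → x ≡ u₁ ⊎ x ≡ u₂) → Spread v

  pathDecomposition : ∀ {k} → (∀ x → length (bag x) ≤ suc k) → (∀ v → ∃[ x ] (v ∈ bag x)) →
    (∀ e → ∃[ x ] (Digraph.tail G e ∈ bag x × Digraph.head G e ∈ bag x)) →
    (∀ v → Spread v) → TreewidthAtMost k G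
  pathDecomposition width cover-v cover-e spread = record
    { t = t ; parent = inject₁ ; parent-< = λ i → ≤-reflexive (toℕ-inject₁ i) ; bag = bag
    ; width = width ; cover-v = cover-v ; cover-e = cover-e ; connected = connected }
    where
    connected : ∀ v x y → v ∈ bag x → v ∈ bag y → Star (StepIn v) x y
    connected v x y v∈x v∈y with spread v
    ... | everywhere v∈              = connected-everywhere v∈ x y
    ... | consecutive u₁ u₂ eq v∈u₁ v∈u₂ only =
      connected-consecutive u₁ u₂ eq v∈u₁ v∈u₂ (only x v∈x) (only y v∈y)

module _ {n : ℕ} where
  open Wheel n using (encV; decV; encV-decV; encV-injective; decE)

  nodeEnum : (Fin (suc n) × Bool) ↔ Fin (suc n * 2)
  nodeEnum = indexedEnum (↔-sym 2↔Bool)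

  toℕ-node : ∀ j b → toℕ (Inverse.to nodeEnum (j , b)) ≡ 2 * toℕ j + toℕ (Inverse.from 2↔Bool b)
  toℕ-node j b = toℕ-combine j _

  wheelBag : Fin (suc n) × Bool → List (Vertex n)
  wheelBag (j , false) = hub ∷ even fzero ∷ even j ∷ odd j ∷ []
  wheelBag (j , true)  = hub ∷ even fzero ∷ odd j ∷ even (next j) ∷ []

  bag : Fin (suc n * 2) → List (Fin (V (wheel n)))
  bag x = map encV (wheelBag (Inverse.from nodeEnum x))

  ∈bag⁺ : ∀ {v} p → v ∈ wheelBag p → encV v ∈ bag (Inverse.to nodeEnum p)
  ∈bag⁺ p v∈ = subst (λ q → _ ∈ map encV (wheelBag q)) (sym (Inverse.strictlyInverseʳ nodeEnum p)) (∈-map⁺ encV v∈)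

  ∈bag⁻ : ∀ {v} x → encV v ∈ bag x → v ∈ wheelBag (Inverse.from nodeEnum x)
  ∈bag⁻ x v∈ with ∈-map⁻ encV v∈
  ... | w , w∈ , eq = subst (_∈ _) (sym (encV-injective eq)) w∈

  hub∈ : ∀ p → hub ∈ wheelBag p
  hub∈ (j , false) = here refl
  hub∈ (j , true)  = here refl

  even0∈ : ∀ p → even fzero ∈ wheelBag p
  even0∈ (j , false) = there (here refl)
  even0∈ (j , true)  = there (here refl)

  odd∈ : ∀ {j} p → odd j ∈ wheelBag p → p ≡ (j , false) ⊎ p ≡ (j , true)
  odd∈ (i , false) (there (there (there (here refl)))) = inj₁ refl
  odd∈ (i , true)  (there (there (here refl)))         = inj₂ refl
  odd∈ (i , true)  (there (there (there (here ()))))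
  odd∈ (i , true)  (there (there (there (there ()))))

  even∈ : ∀ {j} p → j ≢ fzero → even j ∈ wheelBag p → p ≡ (prev j , true) ⊎ p ≡ (j , false)
  even∈ (i , false) j≢0 (there (here refl))                 = ⊥-elim (j≢0 refl)
  even∈ (i , false) j≢0 (there (there (here refl)))         = inj₂ refl
  even∈ (i , false) j≢0 (there (there (there (here ()))))
  even∈ (i , false) j≢0 (there (there (there (there ()))))
  even∈ (i , true)  j≢0 (there (here refl))                 = ⊥-elim (j≢0 refl)
  even∈ (i , true)  j≢0 (there (there (there (here refl)))) = inj₁ (cong (_, true) (sym (prev-next i)))

  open PathDecomposition (wheel n) bag using (Spread; everywhere; consecutive; pathDecomposition)

  toNode : ∀ {x p} → Inverse.from nodeEnum x ≡ p → x ≡ Inverse.to nodeEnum p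
  toNode {x} refl = sym (Inverse.strictlyInverseˡ nodeEnum x)

  toNodes : ∀ {x p q} → Inverse.from nodeEnum x ≡ p ⊎ Inverse.from nodeEnum x ≡ q →
            x ≡ Inverse.to nodeEnum p ⊎ x ≡ Inverse.to nodeEnum q
  toNodes (inj₁ eq) = inj₁ (toNode eq)
  toNodes (inj₂ eq) = inj₂ (toNode eq)

  spread : ∀ w → Spread (encV w)
  spread hub = everywhere (λ x → ∈-map⁺ encV (hub∈ _))
  spread (even j) with j ≟ᶠ fzero
  ... | yes refl = everywhere (λ x → ∈-map⁺ encV (even0∈ _))
  ... | no j≢0   = consecutive _ _ ordered
    (∈bag⁺ (prev j , true) (there (there (there (here (cong even (sym (next-prev j))))))))
    (∈bag⁺ (j , false) (there (there (here refl))))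
    (λ x v∈ → toNodes (even∈ _ j≢0 (∈bag⁻ {even j} x v∈)))
    where
    ordered : toℕ (Inverse.to nodeEnum (j , false)) ≡ suc (toℕ (Inverse.to nodeEnum (prev j , true)))
    ordered = begin
      toℕ (Inverse.to nodeEnum (j , false))             ≡⟨ toℕ-node j false ⟩
      2 * toℕ j + 0                                    ≡⟨ cong (λ m → 2 * m + 0) (suc-toℕ-prev j j≢0) ⟨
      2 * suc (toℕ (prev j)) + 0                       ≡⟨ arithmetic (toℕ (prev j)) ⟩
      suc (2 * toℕ (prev j) + 1)                       ≡⟨ cong suc (toℕ-node (prev j) true) ⟨
      suc (toℕ (Inverse.to nodeEnum (prev j , true)))  ∎
      where
      open ≡-Reasoning
      arithmetic : ∀ m → 2 * suc m + 0 ≡ suc (2 * m + 1)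
      arithmetic = solve-∀
  spread (odd j) = consecutive _ _ ordered
    (∈bag⁺ (j , false) (there (there (there (here refl)))))
    (∈bag⁺ (j , true) (there (there (here refl))))
    (λ x v∈ → toNodes (odd∈ _ (∈bag⁻ {odd j} x v∈)))
    where
    ordered : toℕ (Inverse.to nodeEnum (j , true)) ≡ suc (toℕ (Inverse.to nodeEnum (j , false)))
    ordered = begin
      toℕ (Inverse.to nodeEnum (j , true))       ≡⟨ toℕ-node j true ⟩
      2 * toℕ j + 1                             ≡⟨ arithmetic (toℕ j) ⟩
      suc (2 * toℕ j + 0)                       ≡⟨ cong suc (toℕ-node j false) ⟨
      suc (toℕ (Inverse.to nodeEnum (j , false))) ∎
      where
      open ≡-Reasoning
      arithmetic : ∀ m → 2 * m + 1 ≡ suc (2 * m + 0)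
      arithmetic = solve-∀

  wheel-treewidth : ∀ {k} → 3 ≤ k → TreewidthAtMost k (wheel n)
  wheel-treewidth {k} 3≤k = pathDecomposition width
    (λ v → subst (λ v → ∃[ x ] (v ∈ bag x)) (encV-decV v) (coverVertex (decV v)))
    (λ e → coverEdge (decE e))
    (λ v → subst Spread (encV-decV v) (spread (decV v)))
    where
    width : ∀ x → length (bag x) ≤ suc k
    width x with Inverse.from nodeEnum x
    ... | j , false = s≤s 3≤k
    ... | j , true  = s≤s 3≤k

    at : ∀ {v} p → v ∈ wheelBag p → ∃[ x ] (encV v ∈ bag x)
    at p v∈ = Inverse.to nodeEnum p , ∈bag⁺ p v∈

    coverVertex : ∀ w → ∃[ x ] (encV w ∈ bag x)
    coverVertex hub      = at (fzero , false) (here refl)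
    coverVertex (even j) = at (j , false) (there (there (here refl)))
    coverVertex (odd j)  = at (j , false) (there (there (there (here refl))))

    at₂ : ∀ {u w} p → u ∈ wheelBag p → w ∈ wheelBag p → ∃[ x ] (encV u ∈ bag x × encV w ∈ bag x)
    at₂ p u∈ w∈ = Inverse.to nodeEnum p , ∈bag⁺ p u∈ , ∈bag⁺ p w∈

    coverEdge : ∀ e → ∃[ x ] (encV (source e) ∈ bag x × encV (target e) ∈ bag x)
    coverEdge (j , left)  = at₂ (j , false) (there (there (here refl))) (there (there (there (here refl))))
    coverEdge (j , right) = at₂ (j , true) (there (there (there (here refl)))) (there (there (here refl)))
    coverEdge (j , down₁) = at₂ (j , false) (here refl) (there (there (here refl)))
    coverEdge (j , down₂) = at₂ (j , false) (here refl) (there (there (here refl)))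
    coverEdge (j , up₁)   = at₂ (j , false) (there (there (there (here refl)))) (here refl)
    coverEdge (j , up₂)   = at₂ (j , false) (there (there (there (here refl)))) (here refl)

module _ {c d : A} where

  three-in-pair : {p q r : A} → p ≡ c ⊎ p ≡ d → q ≡ c ⊎ q ≡ d → r ≡ c ⊎ r ≡ d →
                  p ≢ q → p ≢ r → q ≢ r → ⊥
  three-in-pair (inj₁ refl) (inj₁ refl) _           p≢q _   _   = p≢q refl
  three-in-pair (inj₂ refl) (inj₂ refl) _           p≢q _   _   = p≢q refl
  three-in-pair (inj₁ refl) _           (inj₁ refl) _   p≢r _   = p≢r refl
  three-in-pair (inj₂ refl) _           (inj₂ refl) _   p≢r _   = p≢r refl
  three-in-pair _           (inj₁ refl) (inj₁ refl) _   _   q≢r = q≢r refl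
  three-in-pair _           (inj₂ refl) (inj₂ refl) _   _   q≢r = q≢r refl

  two-in-pair : {p q : A} → p ≡ c ⊎ p ≡ d → q ≡ c ⊎ q ≡ d → p ≢ q →
                (c ≡ p ⊎ c ≡ q) × (d ≡ p ⊎ d ≡ q)
  two-in-pair (inj₁ refl) (inj₁ refl) p≢q = ⊥-elim (p≢q refl)
  two-in-pair (inj₂ refl) (inj₂ refl) p≢q = ⊥-elim (p≢q refl)
  two-in-pair (inj₁ refl) (inj₂ refl) _   = inj₁ refl , inj₂ refl
  two-in-pair (inj₂ refl) (inj₁ refl) _   = inj₂ refl , inj₁ refl

module _ {G : Digraph} where

  walk-tail : ∀ {x y f es} → Walk G x y (f ∷ es) → Digraph.tail G f ≡ x
  walk-tail (single e) = refl
  walk-tail (cons e w) = refl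

  walk-head : ∀ {x y f} → Walk G x y (f ∷ []) → y ≡ Digraph.head G f
  walk-head (single e) = refl

  walk-first : ∀ {x y es} → Walk G x y es → ∃[ f ] (f ∈ es × Digraph.tail G f ≡ x)
  walk-first (single e) = e , here refl , refl
  walk-first (cons e w) = e , here refl , refl

odd-injective : ∀ {i j : Fin (suc n)} → _≡_ {A = Vertex n} (odd i) (odd j) → i ≡ j
odd-injective refl = refl

even-injective : ∀ {i j : Fin (suc n)} → _≡_ {A = Vertex n} (even i) (even j) → i ≡ j
even-injective refl = refl

hub≢rim : ∀ {p} → _≡_ {A = Vertex n} hub (inj₂ p) → ⊥
hub≢rim ()

odd≢even : ∀ {i j : Fin (suc n)} → _≡_ {A = Vertex n} (odd i) (even j) → ⊥
odd≢even ()

data RimEdge {n : ℕ} : Edge n → Set where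
  rim-left  : ∀ j → RimEdge (j , left)
  rim-right : ∀ j → RimEdge (j , right)

rimEdge : (e : Edge n) → source e ≢ hub → target e ≢ hub → RimEdge e
rimEdge (j , left)  _ _ = rim-left j
rimEdge (j , right) _ _ = rim-right j
rimEdge (j , down₁) s≢hub _ = ⊥-elim (s≢hub refl)
rimEdge (j , down₂) s≢hub _ = ⊥-elim (s≢hub refl)
rimEdge (j , up₁)   _ t≢hub = ⊥-elim (t≢hub refl)
rimEdge (j , up₂)   _ t≢hub = ⊥-elim (t≢hub refl)

target-rimEdge : ∀ {e : Edge n} → RimEdge e → target e ≡ odd (proj₁ e)
target-rimEdge (rim-left j)  = refl
target-rimEdge (rim-right j) = refl

source-rimEdge≢hub : ∀ {e : Edge n} → RimEdge e → source e ≢ hub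
source-rimEdge≢hub (rim-left j)  ()
source-rimEdge≢hub (rim-right j) ()

target-rimEdge≢hub : ∀ {e : Edge n} → RimEdge e → target e ≢ hub
target-rimEdge≢hub (rim-left j)  ()
target-rimEdge≢hub (rim-right j) ()

leaving-odd : ∀ {j} (e : Edge n) → source e ≡ odd j → target e ≡ hub
leaving-odd (i , up₁) refl = refl
leaving-odd (i , up₂) refl = refl

leaving-rim : (v : Vertex n) → v ≢ hub → ∃[ o₁ ] ∃[ o₂ ] (∀ e → source e ≡ v → e ≡ o₁ ⊎ e ≡ o₂)
leaving-rim hub      v≢hub = ⊥-elim (v≢hub refl)
leaving-rim (even j) _     = (j , left) , (prev j , right) , only
  where
  only : ∀ e → source e ≡ even j → e ≡ (j , left) ⊎ e ≡ (prev j , right)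
  only (i , left)  refl = inj₁ refl
  only (i , right) refl = inj₂ (cong (_, right) (sym (prev-next i)))
leaving-rim (odd j)  _     = (j , up₁) , (j , up₂) , only
  where
  only : ∀ e → source e ≡ odd j → e ≡ (j , up₁) ⊎ e ≡ (j , up₂)
  only (i , up₁) refl = inj₁ refl
  only (i , up₂) refl = inj₂ refl

rimEdge-leaving-even : ∀ {c} {e : Edge n} → RimEdge e → source e ≡ even c → target e ≡ odd c ⊎ target e ≡ odd (prev c)
rimEdge-leaving-even (rim-left j)  refl = inj₁ refl
rimEdge-leaving-even (rim-right j) refl = inj₂ (cong odd (sym (prev-next j)))

rimEdge-entering-odd : ∀ {c} {e : Edge n} → RimEdge e → target e ≡ odd c → source e ≡ even c ⊎ source e ≡ even (next c)
rimEdge-entering-odd (rim-left j)  refl = inj₁ refl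
rimEdge-entering-odd (rim-right j) refl = inj₂ refl

module _ {n : ℕ} where
  open Wheel n using (encV; decE; encV-injective)

  -- after a rim edge the walk stands on an odd vertex, whose only way on is back to the hub
  hubAvoiding-rimEdge : ∀ {x y p} → Walk (wheel n) x y p → x ≢ encV hub → y ≢ encV hub →
    encV hub ∉ internal (wheel n) p →
    ∃[ e ] (RimEdge e × encV (source e) ≡ x × encV (target e) ≡ y)
  hubAvoiding-rimEdge (single e) x≢hub y≢hub _ =
    decE e , rimEdge (decE e) (x≢hub ∘′ cong encV) (y≢hub ∘′ cong encV) , refl , refl
  hubAvoiding-rimEdge {x} {y} (cons e {es = g ∷ es} w) x≢hub y≢hub hub∉ = ⊥-elim (continue es w hub∉)
    where
    e-rim : RimEdge (decE e)
    e-rim = rimEdge (decE e) (x≢hub ∘′ cong encV) (λ eq → hub∉ (here (sym (cong encV eq))))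

    g-to-hub : Digraph.head (wheel n) g ≡ encV hub
    g-to-hub = cong encV (leaving-odd {j = proj₁ (decE e)} (decE g)
      (encV-injective (trans (walk-tail w) (cong encV (target-rimEdge e-rim)))))

    continue : ∀ es → Walk (wheel n) (Digraph.head (wheel n) e) y (g ∷ es) →
               encV hub ∉ internal (wheel n) (e ∷ g ∷ es) → ⊥
    continue []      w _   = y≢hub (trans (walk-head w) g-to-hub)
    continue (_ ∷ _) _ hub∉ = hub∉ (there (here (sym g-to-hub)))

module RimPreserving {a b : ℕ} (ψ : Vertex (suc a) → Vertex b) (ψ-injective : ∀ {u w} → ψ u ≡ ψ w → u ≡ w)
  (ψ-hub : ψ hub ≡ hub)
  (rimImage : ∀ {x} → RimEdge x → ∃[ e ] (RimEdge e × source e ≡ ψ (source x) × target e ≡ ψ (target x))) where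

  ψ-even : ∀ j → ∃[ c ] (ψ (even j) ≡ even c)
  ψ-even j with rimImage (rim-left j)
  ... | (c , left)  , _ , s≡ , _ = c , sym s≡
  ... | (c , right) , _ , s≡ , _ = next c , sym s≡

  ψ-odd : ∀ j → ∃[ c ] (ψ (odd j) ≡ odd c)
  ψ-odd j with rimImage (rim-left j)
  ... | e , e-rim , _ , t≡ = proj₁ e , trans (sym t≡) (target-rimEdge e-rim)

  Image : Vertex b → Set
  Image w = ∃[ u ] (ψ u ≡ w)

  image-of : ∀ {w} u₁ u₂ → w ≡ ψ u₁ ⊎ w ≡ ψ u₂ → Image w
  image-of u₁ u₂ (inj₁ eq) = u₁ , sym eq
  image-of u₁ u₂ (inj₂ eq) = u₂ , sym eq

  evenPreimage : ∀ {c} → Image (even c) → ∃[ j ] (ψ (even j) ≡ even c)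
  evenPreimage (hub , eq)    = ⊥-elim (hub≢rim (trans (sym ψ-hub) eq))
  evenPreimage (even j , eq) = j , eq
  evenPreimage (odd j , eq)  = ⊥-elim (odd≢even (trans (sym (proj₂ (ψ-odd j))) eq))

  oddPreimage : ∀ {c} → Image (odd c) → ∃[ j ] (ψ (odd j) ≡ odd c)
  oddPreimage (hub , eq)    = ⊥-elim (hub≢rim (trans (sym ψ-hub) eq))
  oddPreimage (even j , eq) = ⊥-elim (odd≢even (sym (trans (sym (proj₂ (ψ-even j))) eq)))
  oddPreimage (odd j , eq)  = j , eq

  -- the two rim edges leaving even j have two distinct image edges, both leaving the even ψ-image
  image-even⇒odd : ∀ {c} → Image (even c) → Image (odd c) × Image (odd (prev c))
  image-even⇒odd {c} im with evenPreimage im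
  ... | j , ψj≡ with rimImage (rim-left j) | rimImage (rim-right (prev j))
  ... | e , e-rim , s≡ , t≡ | e' , e'-rim , s'≡ , t'≡ =
    let covered = two-in-pair
          (subst (λ w → w ≡ odd c ⊎ w ≡ odd (prev c)) t≡
            (rimEdge-leaving-even e-rim (trans s≡ ψj≡)))
          (subst (λ w → w ≡ odd c ⊎ w ≡ odd (prev c)) t'≡
            (rimEdge-leaving-even e'-rim (trans s'≡ (trans (cong (ψ ∘′ even) (next-prev j)) ψj≡))))
          (λ eq → prev≢id j (sym (odd-injective (ψ-injective eq))))
    in image-of (odd j) (odd (prev j)) (proj₁ covered) , image-of (odd j) (odd (prev j)) (proj₂ covered)

  image-odd⇒even : ∀ {c} → Image (odd c) → Image (even c) × Image (even (next c))
  image-odd⇒even {c} im with oddPreimage im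
  ... | j , ψj≡ with rimImage (rim-left j) | rimImage (rim-right j)
  ... | e , e-rim , s≡ , t≡ | e' , e'-rim , s'≡ , t'≡ =
    let covered = two-in-pair
          (subst (λ w → w ≡ even c ⊎ w ≡ even (next c)) s≡
            (rimEdge-entering-odd e-rim (trans t≡ ψj≡)))
          (subst (λ w → w ≡ even c ⊎ w ≡ even (next c)) s'≡
            (rimEdge-entering-odd e'-rim (trans t'≡ ψj≡)))
          (λ eq → next≢id j (sym (even-injective (ψ-injective eq))))
    in image-of (even j) (even (next j)) (proj₁ covered) , image-of (even j) (even (next j)) (proj₂ covered)

  image-next : ∀ {c} → Image (even c) → Image (even (next c))
  image-next im = proj₂ (image-odd⇒even (proj₁ (image-even⇒odd im)))

  image-iter : ∀ m {c} → Image (even c) → Image (even (iter next m c))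
  image-iter zero    im = im
  image-iter (suc m) im = image-next (image-iter m im)

  ψ-surjective : ∀ w → Image w
  ψ-surjective hub      = hub , ψ-hub
  ψ-surjective (even c) with next-transitive (proj₁ (ψ-even fzero)) c
  ... | m , refl = image-iter m (even fzero , proj₂ (ψ-even fzero))
  ψ-surjective (odd c)  = proj₁ (image-even⇒odd (ψ-surjective (even c)))

module NoStrongImmersion {a b : ℕ} (I : StrongImmersion (wheel (suc a)) (wheel b)) where
  open StrongImmersion I
  module H = Wheel (suc a)
  module G = Wheel b

  ψ : Vertex (suc a) → Vertex b
  ψ u = G.decV (φ (H.encV u))

  φ-encV : ∀ u → φ (H.encV u) ≡ G.encV (ψ u)
  φ-encV u = sym (G.encV-decV _)

  ψ-injective : ∀ {u w} → ψ u ≡ ψ w → u ≡ w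
  ψ-injective {u} {w} eq = H.encV-injective (φ-inj (trans (φ-encV u) (trans (cong G.encV eq) (sym (φ-encV w)))))

  walkOf : ∀ x → Walk (wheel b) (G.encV (ψ (source x))) (G.encV (ψ (target x))) (path (H.encE x))
  walkOf x = subst₂ (λ y z → Walk (wheel b) y z (path (H.encE x)))
    (trans (cong φ (H.tail-encE x)) (φ-encV (source x))) (trans (cong φ (H.head-encE x)) (φ-encV (target x)))
    (proj₁ (path-ok (H.encE x)))

  firstEdge : Edge (suc a) → Edge b
  firstEdge x = G.decE (proj₁ (walk-first (walkOf x)))

  source-firstEdge : ∀ x → source (firstEdge x) ≡ ψ (source x)
  source-firstEdge x = G.encV-injective (proj₂ (proj₂ (walk-first (walkOf x))))

  firstEdge-injective : ∀ {x y} → x ≢ y → firstEdge x ≢ firstEdge y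
  firstEdge-injective {x} {y} x≢y eq = disjoint (H.encE x) (H.encE y) (x≢y ∘′ H.encE-injective) _
    (proj₁ (proj₂ (walk-first (walkOf x))))
    (subst (_∈ path (H.encE y)) (sym (G.decE-injective eq)) (proj₁ (proj₂ (walk-first (walkOf y)))))

  -- the hub has three edges leaving it with distinct first edges, a rim vertex only two out-edges
  ψ-hub : ψ hub ≡ hub
  ψ-hub with ψ hub in ψhub≡
  ... | hub = refl
  ... | inj₂ p with leaving-rim (inj₂ p) (λ ())
  ...   | o₁ , o₂ , only = ⊥-elim (three-in-pair (out d₁ refl) (out d₂ refl) (out d₃ refl)
            (firstEdge-injective {d₁} {d₂} λ ()) (firstEdge-injective {d₁} {d₃} λ ())
            (firstEdge-injective {d₂} {d₃} λ ()))
    where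
    d₁ d₂ d₃ : Edge (suc a)
    d₁ = fzero , down₁
    d₂ = fzero , down₂
    d₃ = fsuc fzero , down₁

    out : ∀ x → source x ≡ hub → firstEdge x ≡ o₁ ⊎ firstEdge x ≡ o₂
    out x from-hub = only (firstEdge x) (trans (source-firstEdge x) (trans (cong ψ from-hub) ψhub≡))

  ψ-off-hub : ∀ {u} → u ≢ hub → G.encV (ψ u) ≢ G.encV hub
  ψ-off-hub u≢hub eq = u≢hub (ψ-injective (trans (G.encV-injective eq) (sym ψ-hub)))

  hub∉internal : ∀ x → G.encV hub ∉ internal (wheel b) (path (H.encE x))
  hub∉internal x = subst (λ v → v ∉ internal (wheel b) (path (H.encE x)))
    (trans (φ-encV hub) (cong G.encV ψ-hub)) (strong (H.encV hub) (H.encE x))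

  rimImage : ∀ {x} → RimEdge x → ∃[ e ] (RimEdge e × source e ≡ ψ (source x) × target e ≡ ψ (target x))
  rimImage {x} x-rim with hubAvoiding-rimEdge (walkOf x)
    (ψ-off-hub (source-rimEdge≢hub x-rim)) (ψ-off-hub (target-rimEdge≢hub x-rim)) (hub∉internal x)
  ... | e , e-rim , s≡ , t≡ = e , e-rim , G.encV-injective s≡ , G.encV-injective t≡

  open RimPreserving ψ ψ-injective ψ-hub rimImage using (ψ-surjective)

  section : Fin (V (wheel b)) → Fin (V (wheel (suc a)))
  section v = H.encV (proj₁ (ψ-surjective (G.decV v)))

  φ-section : ∀ v → φ (section v) ≡ v
  φ-section v = trans (φ-encV (proj₁ preimage)) (trans (cong G.encV (proj₂ preimage)) (G.encV-decV v))
    where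
    preimage : ∃[ u ] (ψ u ≡ G.decV v)
    preimage = ψ-surjective (G.decV v)

  vertices-≤ : V (wheel b) ≤ V (wheel (suc a))
  vertices-≤ = injective⇒≤ {f = section} λ {v} {w} eq → trans (sym (φ-section v)) (trans (cong φ eq) (φ-section w))

no-strong-immersion : ∀ {a b} → suc a < b → ¬ StrongImmersion (wheel (suc a)) (wheel b)
no-strong-immersion {a} {b} a<b I = <-irrefl refl (<-≤-trans a<b b≤a)
  where
  b≤a : b ≤ suc a
  b≤a = s≤s⁻¹ (*-cancelʳ-≤ (suc b) (suc (suc a)) 2 (s≤s⁻¹ (NoStrongImmersion.vertices-≤ I)))

corollary1p2 : ∀ (k : ℕ) → 3 ≤ k →
    Σ (ℕ → Digraph) (λ G →
      (∀ i → InClass k (G i)) ×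
      (∀ i j → i < j → ¬ StrongImmersion (G i) (G j)))
corollary1p2 k 3≤k = (λ i → wheel (suc i)) ,
  (λ i → wheel-eulerian (suc i) , wheel-planar (suc i) , wheel-treewidth 3≤k) ,
  (λ i j i<j → no-strong-immersion (s≤s i<j))
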